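{- Every finite simple undirected graph $G=(V,E)$ has an optimal cograph edit set $F$ such that, with $H=(V,E\triangle F)$, every strong module $M^\star$ of $H$ that is not a module of $G$ is obtained by merging (with respect to $H$) modules in $\mathbb{P}_{\max}(G[P_{M^\star}])$ for some prime module $P_{M^\star}$ of $G$; that is, there exist $M_1,\dots,M_k\in\mathbb{P}_{\max}(G[P_{M^\star}])$ with $M^\star=\bigcup_{i=1}^k M_i$ which are merged with respect to $H$ into $M^\star$.
   Context: A module of $G$ is a set $M\subseteq V$ with $N(x)\setminus M=N(y)\setminus M$ for all $x,y\in M$ ($N(v)$ the neighborhood). A module $M$ is strong if $M\cap M'\in\{\emptyset,M,M'\}$ for every module $M'$ of $G$. For a strong module $M$ with $|M|\ge2$, $\mathbb{P}_{\max}(G[M])$ is the set of inclusion-maximal strong modules of $G$ properly contained in $M$. A strong module $M$ with $|M|\ge2$ is prime if $G[M]$ and its complement are both connected. A cograph is a graph with no induced path on four vertices. For $F\subseteq\binom V2$, $G\triangle F=(V,E\triangle F)$; $F$ is a cograph edit set if $G\triangle F$ is a cograph, and optimal if of minimum cardinality among such sets. For graphs $G,H$ on the same vertex set and modules $M_1,\dots,M_k$ of $G$, they are merged with respect to $H$ into $M=\bigcup_i M_i$ if each $M_i$ is a module of $H$, $M$ is a module of $H$, and $M$ is not a module of $G$. -}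

module Defs where

open import Data.Nat using (ℕ; zero; suc; _+_; _≤_; _<_)
open import Data.Fin using (Fin; toℕ)
open import Data.Bool using (Bool; true; false; _xor_; not)
open import Data.List using (List; map; allFin)
open import Data.Nat.ListAction using (sum)
open import Data.List.Relation.Unary.All using (All)
open import Data.List.Relation.Unary.Any using (Any)
open import Data.Product using (Σ; ∃; _×_; _,_)
open import Data.Sum using (_⊎_)
open import Data.Empty using (⊥)
open import Relation.Nullary using (¬_)
open import Relation.Binary.PropositionalEquality using (_≡_; _≢_; refl; sym; trans; cong₂)
open import Function.Bundles using (_⇔_)

record Graph (n : ℕ) : Set where
  field
    adj    : Fin n → Fin n → Bool
    symm   : ∀ x y → adj x y ≡ adj y x
    irrefl : ∀ x → adj x x ≡ false
open Graph public

Edge : ∀ {n} → Graph n → Fin n → Fin n → Set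
Edge G x y = adj G x y ≡ true

-- An edit set F ⊆ (V choose 2) is represented as a symmetric irreflexive
-- Boolean relation, i.e. again as a Graph on V.
EditSet : ℕ → Set
EditSet = Graph

private
  xor-false : ∀ b → b xor false ≡ b
  xor-false true = refl
  xor-false false = refl

_△_ : ∀ {n} → Graph n → EditSet n → Graph n
adj (G △ F) x y = adj G x y xor adj F x y
symm (G △ F) x y = cong₂ _xor_ (symm G x y) (symm F x y)
irrefl (G △ F) x rewrite irrefl G x | irrefl F x = refl

-- |F| : number of unordered pairs {x,y} (x < y) in F.
bool→ℕ : Bool → ℕ
bool→ℕ true = 1
bool→ℕ false = 0

ltB : ℕ → ℕ → Bool
ltB zero (suc _) = true
ltB _ zero = false
ltB (suc m) (suc k) = ltB m k

_∧b_ : Bool → Bool → Bool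
true ∧b b = b
false ∧b _ = false

card : ∀ {n} → EditSet n → ℕ
card {n} F = sum (map (λ x → sum (map (λ y → bool→ℕ (ltB (toℕ x) (toℕ y) ∧b adj F x y)) (allFin n))) (allFin n))

IsCograph : ∀ {n} → Graph n → Set
IsCograph {n} G = ∀ (a b c d : Fin n) →
  a ≢ b → a ≢ c → a ≢ d → b ≢ c → b ≢ d → c ≢ d →
  Edge G a b → Edge G b c → Edge G c d →
  adj G a c ≡ false → adj G b d ≡ false → adj G a d ≡ false → ⊥

IsCographEditSet : ∀ {n} → Graph n → EditSet n → Set
IsCographEditSet G F = IsCograph (G △ F)

IsOptimalEditSet : ∀ {n} → Graph n → EditSet n → Set
IsOptimalEditSet {n} G F =
  IsCographEditSet G F × (∀ (F' : EditSet n) → IsCographEditSet G F' → card F ≤ card F')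

VSet : ℕ → Set
VSet n = Fin n → Bool

_∈_ : ∀ {n} → Fin n → VSet n → Set
x ∈ M = M x ≡ true

_∉_ : ∀ {n} → Fin n → VSet n → Set
x ∉ M = M x ≡ false

_⊆_ : ∀ {n} → VSet n → VSet n → Set
A ⊆ B = ∀ x → x ∈ A → x ∈ B

IsModule : ∀ {n} → Graph n → VSet n → Set
IsModule G M = ∀ x y z → x ∈ M → y ∈ M → z ∉ M → adj G x z ≡ adj G y z

Overlap-ok : ∀ {n} → VSet n → VSet n → Set
Overlap-ok M M' = (∀ z → z ∈ M → z ∈ M' → ⊥) ⊎ (M ⊆ M' ⊎ M' ⊆ M)

IsStrongModule : ∀ {n} → Graph n → VSet n → Set
IsStrongModule {n} G M = IsModule G M × (∀ (M' : VSet n) → IsModule G M' → Overlap-ok M M')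

AtLeastTwo : ∀ {n} → VSet n → Set
AtLeastTwo M = ∃ λ x → ∃ λ y → x ∈ M × y ∈ M × x ≢ y

_⊂_ : ∀ {n} → VSet n → VSet n → Set
A ⊂ B = A ⊆ B × ∃ λ x → x ∈ B × x ∉ A

-- M' ∈ P_max(G[M]): inclusion-maximal strong modules of G properly contained in M
InPmax : ∀ {n} → Graph n → VSet n → VSet n → Set
InPmax {n} G M M' =
  IsStrongModule G M' × M' ⊂ M ×
  (∀ (M'' : VSet n) → IsStrongModule G M'' → M'' ⊂ M → M' ⊆ M'' → M'' ⊆ M')

data Reach {n} (R : Fin n → Fin n → Bool) (M : VSet n) : Fin n → Fin n → Set where
  here : ∀ {x} → Reach R M x x
  step : ∀ {x y z} → R x y ≡ true → y ∈ M → Reach R M y z → Reach R M x z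

ConnectedOn : ∀ {n} → (Fin n → Fin n → Bool) → VSet n → Set
ConnectedOn R M = ∀ x y → x ∈ M → y ∈ M → Reach R M x y

coAdj : ∀ {n} → Graph n → Fin n → Fin n → Bool
coAdj G x y = not (adj G x y)

-- coAdj G x x = true, but loops are irrelevant for reachability
IsPrimeModule : ∀ {n} → Graph n → VSet n → Set
IsPrimeModule G M =
  IsStrongModule G M × AtLeastTwo M × ConnectedOn (adj G) M × ConnectedOn (coAdj G) M

InUnion : ∀ {n} → List (VSet n) → Fin n → Set
InUnion Ms x = Any (λ Mi → x ∈ Mi) Ms

MergedInto : ∀ {n} → Graph n → Graph n → List (VSet n) → VSet n → Set
MergedInto G H Ms M =
  All (IsModule G) Ms × All (IsModule H) Ms × IsModule H M × ¬ IsModule G M ×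
  (∀ x → (x ∈ M) ⇔ InUnion Ms x)

-- The proof has three parts.
--  * Finite search: vertex sets and edit relations can be listed up to pointwise
--    equality, so being a strong module is decidable and optimal edit sets,
--    least strong modules, etc. exist as minimisers (`Search`).
--  * Stabilisation: for an optimal F and a strong module M of G, joining all of M
--    to the outside like its cheapest member keeps a cograph edit set (a P4 meets
--    a module in at most one or in all four vertices) and does not increase its
--    size (counting edits over ordered pairs split along M); modules not
--    overlapping M survive.  Stabilising every strong module of G in turn yields
--    an optimal F keeping them all modules of H (`module-preserving-optimal`).
--  * Merging: a strong module M of such an H that is not a module of G overlaps no
--    strong module of G properly.  The least strong module P of G containing M is
--    connected and co-connected, because components of a strong module are strong
--    modules (`Connectivity`), hence prime, and M is the union of the maximal strong
--    submodules of P that it meets (`merge-of-children`).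
module Submission where

open import Defs
open import Data.Nat using (ℕ; zero; suc; _+_; _≤_; _<_; z≤n; s≤s; _≤?_)
open import Data.Nat.Properties using (≤-refl; ≤-trans; ≤-reflexive; ≤-<-trans; +-mono-≤; +-mono-<-≤; +-mono-≤-<; +-identityʳ; +-mono-<; ≰⇒>; <⇒≱; +-0-commutativeMonoid)
open import Data.Nat.ListAction using (sum)
open import Data.Bool using (Bool; true; false; _xor_; not) renaming (_≟_ to _≟ᵇ_)
open import Data.Bool.Properties using (xor-same; xor-assoc; not-injective)
open import Data.Fin using (Fin; zero; suc; toℕ)
open import Data.Fin.Properties using (toℕ-injective; all?; any?) renaming (_≟_ to _≟ᶠ_)
open import Data.Vec.Functional using (Vector) renaming (_∷_ to _∷ᵥ_)
open import Data.Vec.Functional.Relation.Binary.Pointwise using (Pointwise)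
open import Data.List using (List; []; _∷_; [_]; map; tabulate; allFin; cartesianProductWith; filter)
open import Data.List.Relation.Unary.All as All using (All)
open import Data.List.Relation.Unary.All.Properties using (all-filter)
open import Data.List.Relation.Unary.Any using (Any; here; there)
open import Data.List.Relation.Unary.Any.Properties using (cartesianProductWith⁺; filter⁺; lookup-result; tabulate⁺)
open import Data.List.Extrema.Nat using (argmin; argmin-all; f[argmin]≤f[xs])
open import Data.Product using (Σ; ∃; _×_; _,_; proj₁; proj₂)
open import Data.Sum using (_⊎_; inj₁; inj₂)
open import Data.Empty using (⊥; ⊥-elim)
open import Relation.Nullary using (¬_; Dec; yes; no)
open import Relation.Nullary.Decidable using (map′; _×-dec_; _⊎-dec_; _→-dec_; ¬?; decidable-stable; does; dec-true; dec-false)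
open import Function.Bundles using (mk⇔)
open import Relation.Binary.PropositionalEquality using (_≡_; _≢_; refl; sym; trans; cong; cong₂; subst; subst₂; _≗_)
open import Algebra.Properties.CommutativeMonoid.Sum +-0-commutativeMonoid using (∑-comm; ∑-distrib-+; sum-cong-≗) renaming (sum to ∑)
open Relation.Binary.PropositionalEquality.≡-Reasoning

Covers : ∀ {A : Set} → (A → A → Set) → List A → Set
Covers {A} _≈_ xs = ∀ (a : A) → Any (_≈ a) xs

vectors : ∀ {A : Set} → List A → (n : ℕ) → List (Vector A n)
vectors as zero = [ (λ ()) ]
vectors as (suc n) = cartesianProductWith _∷ᵥ_ as (vectors as n)

vectors-cover : ∀ {A : Set} {_≈_ : A → A → Set} {as : List A} →
  Covers _≈_ as → ∀ n → Covers (Pointwise _≈_) (vectors as n)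
vectors-cover cover zero f = here (λ ())
vectors-cover cover (suc n) f =
  cartesianProductWith⁺ _∷ᵥ_ (λ a≈ g≈ → λ { zero → a≈ ; (suc i) → g≈ i })
    (cover (f zero)) (vectors-cover cover n (λ i → f (suc i)))

bools : List Bool
bools = false ∷ true ∷ []

bools-cover : Covers _≡_ bools
bools-cover false = here refl
bools-cover true = there (here refl)

vsets : (n : ℕ) → List (VSet n)
vsets n = vectors bools n

vsets-cover : ∀ {n} → Covers _≗_ (vsets n)
vsets-cover {n} = vectors-cover bools-cover n

Rel₂ : ℕ → Set
Rel₂ n = Fin n → Fin n → Bool

_≐_ : ∀ {n} → Rel₂ n → Rel₂ n → Set
R ≐ S = ∀ x y → R x y ≡ S x y

relations : (n : ℕ) → List (Rel₂ n)
relations n = vectors (vsets n) n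

relations-cover : ∀ {n} → Covers _≐_ (relations n)
relations-cover {n} = vectors-cover vsets-cover n

vertices-cover : ∀ {n} → Covers _≡_ (allFin n)
vertices-cover a = tabulate⁺ a refl

Least : ∀ {A : Set} → (A → Set) → (A → ℕ) → Set
Least {A} P μ = Σ A λ a → P a × (∀ b → P b → μ a ≤ μ b)

module Search {A : Set} {_≈_ : A → A → Set} {xs : List A} (cover : Covers _≈_ xs) where

  all-dec : ∀ {Q : A → Set} → (∀ a → Dec (Q a)) → (∀ {a b} → a ≈ b → Q a → Q b) →
    Dec (∀ a → Q a)
  all-dec Q? resp = map′
    (λ qs a → All.lookupWith (λ qc c≈a → resp c≈a qc) qs (cover a))
    (λ q → All.tabulate (λ {x} _ → q x))
    (All.all? Q? xs)

  least : ∀ {P : A → Set} (μ : A → ℕ) → (∀ a → Dec (P a)) →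
    (∀ {a b} → a ≈ b → P b → P a) → (∀ {a b} → a ≈ b → μ a ≡ μ b) →
    ∀ {a₀} → P a₀ → Least P μ
  least {P} μ P? resp μ-resp {a₀} pa₀ = best , argmin-all μ pa₀ (all-filter P? xs) , below
    where
    best : A
    best = argmin μ a₀ (filter P? xs)
    below : ∀ b → P b → μ best ≤ μ b
    below b pb with filter⁺ P? (cover b)
    ... | inj₁ hit = All.lookupWith (λ le c≈b → ≤-trans le (≤-reflexive (μ-resp c≈b)))
                       (f[argmin]≤f[xs] {f = μ} a₀ (filter P? xs)) hit
    ... | inj₂ ¬pc = ⊥-elim (¬pc (resp (lookup-result (cover b)) pb))

sum-map-tabulate : ∀ {A : Set} {n} (g : Fin n → A) (f : A → ℕ) →
  sum (map f (tabulate g)) ≡ ∑ (λ i → f (g i))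
sum-map-tabulate {n = zero} g f = refl
sum-map-tabulate {n = suc n} g f = cong (f (g zero) +_) (sum-map-tabulate (λ i → g (suc i)) f)

∑-mono : ∀ {n} {f g : Fin n → ℕ} → (∀ i → f i ≤ g i) → ∑ f ≤ ∑ g
∑-mono {zero} f≤g = z≤n
∑-mono {suc n} f≤g = +-mono-≤ (f≤g zero) (∑-mono (λ i → f≤g (suc i)))

∑-strict : ∀ {n} {f g : Fin n → ℕ} → (∀ i → f i ≤ g i) → ∀ i → f i < g i → ∑ f < ∑ g
∑-strict f≤g zero lt = +-mono-<-≤ lt (∑-mono (λ i → f≤g (suc i)))
∑-strict f≤g (suc i) lt = +-mono-≤-< (f≤g zero) (∑-strict (λ j → f≤g (suc j)) i lt)

∑∑ : ∀ {n} → (Fin n → Fin n → ℕ) → ℕ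
∑∑ f = ∑ (λ x → ∑ (f x))

∑∑-cong : ∀ {n} {f g : Fin n → Fin n → ℕ} → (∀ x y → f x y ≡ g x y) → ∑∑ f ≡ ∑∑ g
∑∑-cong f≡g = sum-cong-≗ (λ x → sum-cong-≗ (f≡g x))

∑∑-distrib-+ : ∀ {n} (f g : Fin n → Fin n → ℕ) → ∑∑ (λ x y → f x y + g x y) ≡ ∑∑ f + ∑∑ g
∑∑-distrib-+ f g = trans (sum-cong-≗ (λ x → ∑-distrib-+ (f x) (g x))) (∑-distrib-+ (λ x → ∑ (f x)) (λ x → ∑ (g x)))

ltB-trichotomy : ∀ m k →
  m ≡ k ⊎ (ltB m k ≡ true × ltB k m ≡ false) ⊎ (ltB m k ≡ false × ltB k m ≡ true)
ltB-trichotomy zero zero = inj₁ refl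
ltB-trichotomy zero (suc k) = inj₂ (inj₁ (refl , refl))
ltB-trichotomy (suc m) zero = inj₂ (inj₂ (refl , refl))
ltB-trichotomy (suc m) (suc k) with ltB-trichotomy m k
... | inj₁ m≡k = inj₁ (cong suc m≡k)
... | inj₂ lt-or-gt = inj₂ lt-or-gt

cardRel : ∀ {n} → Rel₂ n → ℕ
cardRel {n} f = sum (map (λ x → sum (map (λ y → bool→ℕ (ltB (toℕ x) (toℕ y) ∧b f x y)) (allFin n))) (allFin n))

upper : ∀ {n} → Rel₂ n → Fin n → Fin n → ℕ
upper f x y = bool→ℕ (ltB (toℕ x) (toℕ y) ∧b f x y)

cardRel-∑∑ : ∀ {n} (f : Rel₂ n) → cardRel f ≡ ∑∑ (upper f)
cardRel-∑∑ {n} f = trans (sum-map-tabulate (λ x → x) (λ x → sum (map (upper f x) (allFin n))))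
                         (sum-cong-≗ (λ x → sum-map-tabulate (λ y → y) (upper f x)))

cardRel-cong : ∀ {n} {f g : Rel₂ n} → f ≐ g → cardRel f ≡ cardRel g
cardRel-cong {f = f} {g} f≐g = begin
  cardRel f      ≡⟨ cardRel-∑∑ f ⟩
  ∑∑ (upper f)   ≡⟨ ∑∑-cong (λ x y → cong (λ b → bool→ℕ (ltB (toℕ x) (toℕ y) ∧b b)) (f≐g x y)) ⟩
  ∑∑ (upper g)   ≡⟨ sym (cardRel-∑∑ g) ⟩
  cardRel g      ∎

upper-split : ∀ {n} (F : EditSet n) x y → bool→ℕ (adj F x y) ≡ upper (adj F) x y + upper (adj F) y x
upper-split F x y with ltB-trichotomy (toℕ x) (toℕ y)
... | inj₁ x≡y with toℕ-injective x≡y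
...   | refl rewrite irrefl F x with ltB (toℕ x) (toℕ x)
...     | true = refl
...     | false = refl
upper-split F x y | inj₂ (inj₁ (x<y , y≮x)) rewrite x<y | y≮x = sym (+-identityʳ _)
upper-split F x y | inj₂ (inj₂ (x≮y , y<x)) rewrite x≮y | y<x = cong bool→ℕ (symm F x y)

pairs : ∀ {n} → EditSet n → ℕ
pairs F = ∑∑ (λ x y → bool→ℕ (adj F x y))

pairs≡2card : ∀ {n} (F : EditSet n) → pairs F ≡ card F + card F
pairs≡2card F = begin
  pairs F                                 ≡⟨ ∑∑-cong (upper-split F) ⟩
  ∑∑ (λ x y → u x y + u y x)              ≡⟨ ∑∑-distrib-+ u (λ x y → u y x) ⟩
  ∑∑ u + ∑∑ (λ x y → u y x)               ≡⟨ cong (∑∑ u +_) (sym (∑-comm u)) ⟩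
  ∑∑ u + ∑∑ u                             ≡⟨ cong₂ _+_ (sym (cardRel-∑∑ (adj F))) (sym (cardRel-∑∑ (adj F))) ⟩
  card F + card F                         ∎
  where
  u : Fin _ → Fin _ → ℕ
  u = upper (adj F)

double-cancel-≤ : ∀ a b → a + a ≤ b + b → a ≤ b
double-cancel-≤ a b a+a≤b+b with a ≤? b
... | yes a≤b = a≤b
... | no a≰b = ⊥-elim (<⇒≱ (+-mono-< (≰⇒> a≰b) (≰⇒> a≰b)) a+a≤b+b)

pairs-≤⇒card-≤ : ∀ {n} (F F' : EditSet n) → pairs F ≤ pairs F' → card F ≤ card F'
pairs-≤⇒card-≤ F F' le =
  double-cancel-≤ (card F) (card F') (subst₂ _≤_ (pairs≡2card F) (pairs≡2card F') le)

∈? : ∀ {n} (x : Fin n) (M : VSet n) → Dec (x ∈ M)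
∈? x M = M x ≟ᵇ true

∉? : ∀ {n} (x : Fin n) (M : VSet n) → Dec (x ∉ M)
∉? x M = M x ≟ᵇ false

true≢false : true ≢ false
true≢false ()

-- Case split on membership without abstracting `M x` in the goal.
member? : ∀ {n} (x : Fin n) (M : VSet n) → x ∈ M ⊎ x ∉ M
member? x M with M x
... | true  = inj₁ refl
... | false = inj₂ refl

¬∉⇒∈ : ∀ {n} {A : VSet n} {x} → ¬ (x ∉ A) → x ∈ A
¬∉⇒∈ {A = A} {x} ¬x∉A with member? x A
... | inj₁ x∈A = x∈A
... | inj₂ x∉A = ⊥-elim (¬x∉A x∉A)

disjoint-∉ : ∀ {n} {A B : VSet n} {x} → (∀ z → z ∈ A → z ∈ B → ⊥) → x ∈ B → x ∉ A
disjoint-∉ {A = A} {x = x} disjoint x∈B with member? x A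
... | inj₁ x∈A = ⊥-elim (disjoint x x∈A x∈B)
... | inj₂ x∉A = x∉A

⊆-∉ : ∀ {n} {A B : VSet n} {x} → A ⊆ B → x ∉ B → x ∉ A
⊆-∉ {A = A} {x = x} A⊆B x∉B with member? x A
... | inj₁ x∈A = ⊥-elim (true≢false (trans (sym (A⊆B x x∈A)) x∉B))
... | inj₂ x∉A = x∉A

∈-resp : ∀ {n} {A B : VSet n} {x} → A ≗ B → x ∈ A → x ∈ B
∈-resp {x = x} A≗B x∈A = trans (sym (A≗B x)) x∈A

∉-resp : ∀ {n} {A B : VSet n} {x} → A ≗ B → x ∉ A → x ∉ B
∉-resp {x = x} A≗B x∉A = trans (sym (A≗B x)) x∉A

≗-sym : ∀ {n} {A B : VSet n} → A ≗ B → B ≗ A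
≗-sym A≗B x = sym (A≗B x)

⊆-resp : ∀ {n} {A A' B B' : VSet n} → A ≗ A' → B ≗ B' → A ⊆ B → A' ⊆ B'
⊆-resp A≗A' B≗B' A⊆B x x∈A' = ∈-resp B≗B' (A⊆B x (∈-resp (≗-sym A≗A') x∈A'))

overlap-resp : ∀ {n} {A A' B B' : VSet n} → A ≗ A' → B ≗ B' → Overlap-ok A B → Overlap-ok A' B'
overlap-resp A≗A' B≗B' (inj₁ disjoint) =
  inj₁ (λ z z∈A' z∈B' → disjoint z (∈-resp (≗-sym A≗A') z∈A') (∈-resp (≗-sym B≗B') z∈B'))
overlap-resp A≗A' B≗B' (inj₂ (inj₁ A⊆B)) = inj₂ (inj₁ (⊆-resp A≗A' B≗B' A⊆B))
overlap-resp A≗A' B≗B' (inj₂ (inj₂ B⊆A)) = inj₂ (inj₂ (⊆-resp B≗B' A≗A' B⊆A))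

module-resp : ∀ {n} (G : Graph n) {A B : VSet n} → A ≗ B → IsModule G A → IsModule G B
module-resp G {A} {B} A≗B modA x y z x∈B y∈B z∉B =
  modA x y z (∈-resp B≗A x∈B) (∈-resp B≗A y∈B) (∉-resp B≗A z∉B)
  where
  B≗A : B ≗ A
  B≗A = ≗-sym A≗B

strong-resp : ∀ {n} (G : Graph n) {A B : VSet n} → A ≗ B → IsStrongModule G A → IsStrongModule G B
strong-resp G A≗B (modA , overlapsA) =
  module-resp G A≗B modA , λ M' modM' → overlap-resp A≗B (λ _ → refl) (overlapsA M' modM')

⊆? : ∀ {n} (A B : VSet n) → Dec (A ⊆ B)
⊆? A B = all? λ x → ∈? x A →-dec ∈? x B

overlap? : ∀ {n} (A B : VSet n) → Dec (Overlap-ok A B)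
overlap? A B = (all? λ z → ∈? z A →-dec ∈? z B →-dec no (λ ())) ⊎-dec (⊆? A B ⊎-dec ⊆? B A)

module? : ∀ {n} (G : Graph n) (M : VSet n) → Dec (IsModule G M)
module? G M = all? λ x → all? λ y → all? λ z →
  ∈? x M →-dec ∈? y M →-dec ∉? z M →-dec (adj G x z ≟ᵇ adj G y z)

strong? : ∀ {n} (G : Graph n) (M : VSet n) → Dec (IsStrongModule G M)
strong? G M = module? G M ×-dec Search.all-dec vsets-cover
  (λ M' → module? G M' →-dec overlap? M M')
  (λ M'≗M'' overlaps modM'' → overlap-resp (λ _ → refl) M'≗M''
                                 (overlaps (module-resp G (≗-sym M'≗M'') modM'')))

module-≐ : ∀ {n} {K K' : Graph n} → adj K ≐ adj K' → ∀ M → IsModule K M → IsModule K' M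
module-≐ K≐K' M modK x y z x∈M y∈M z∉M =
  trans (sym (K≐K' x z)) (trans (modK x y z x∈M y∈M z∉M) (K≐K' y z))

record InducedP4 {n} (R : Rel₂ n) (a b c d : Fin n) : Set where
  constructor p4
  field
    ab : R a b ≡ true
    bc : R b c ≡ true
    cd : R c d ≡ true
    ac : R a c ≡ false
    bd : R b d ≡ false
    ad : R a d ≡ false

P4-free : ∀ {n} → Rel₂ n → Set
P4-free R = ∀ a b c d → ¬ InducedP4 R a b c d

P4-free? : ∀ {n} (R : Rel₂ n) → Dec (P4-free R)
P4-free? R = all? λ a → all? λ b → all? λ c → all? λ d → ¬? (induced? a b c d)
  where
  induced? : ∀ a b c d → Dec (InducedP4 R a b c d)
  induced? a b c d = map′
    (λ (ab , bc , cd , ac , bd , ad) → p4 ab bc cd ac bd ad)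
    (λ (p4 ab bc cd ac bd ad) → ab , bc , cd , ac , bd , ad)
    (R a b ≟ᵇ true ×-dec R b c ≟ᵇ true ×-dec R c d ≟ᵇ true ×-dec
     R a c ≟ᵇ false ×-dec R b d ≟ᵇ false ×-dec R a d ≟ᵇ false)

-- The vertices of an induced P4 are pairwise distinct, so the distinctness
-- hypotheses in `IsCograph` are automatic.
cograph⇒P4-free : ∀ {n} (K : Graph n) → IsCograph K → P4-free (adj K)
cograph⇒P4-free K cog a b c d (p4 ab bc cd ac bd ad) =
  cog a b c d a≢b a≢c a≢d b≢c b≢d c≢d ab bc cd ac bd ad
  where
  loopless : ∀ {x y} → adj K x y ≡ true → x ≢ y
  loopless {x} xy refl = true≢false (trans (sym xy) (irrefl K x))
  a≢b : a ≢ b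
  a≢b = loopless ab
  b≢c : b ≢ c
  b≢c = loopless bc
  c≢d : c ≢ d
  c≢d = loopless cd
  a≢c : a ≢ c
  a≢c refl = true≢false (trans (sym cd) ad)
  b≢d : b ≢ d
  b≢d refl = true≢false (trans (sym ab) ad)
  a≢d : a ≢ d
  a≢d refl = true≢false (trans (sym ab) (trans (symm K a b) bd))

P4-free⇒cograph : ∀ {n} (K : Graph n) → P4-free (adj K) → IsCograph K
P4-free⇒cograph K free a b c d _ _ _ _ _ _ ab bc cd ac bd ad = free a b c d (p4 ab bc cd ac bd ad)

record OnPairs {n} (_~_ : Fin n → Fin n → Set) (a b c d : Fin n) : Set where
  constructor on-pairs
  field
    ab : a ~ b
    bc : b ~ c
    cd : c ~ d
    ac : a ~ c
    bd : b ~ d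
    ad : a ~ d

OnPairs-map : ∀ {n} {_~_ _≈_ : Fin n → Fin n → Set} {a b c d} →
  (∀ {p q} → p ~ q → p ≈ q) → OnPairs _~_ a b c d → OnPairs _≈_ a b c d
OnPairs-map f (on-pairs ab bc cd ac bd ad) = on-pairs (f ab) (f bc) (f cd) (f ac) (f bd) (f ad)

P4-map : ∀ {n} {R S : Rel₂ n} (σ : Fin n → Fin n) {a b c d} →
  OnPairs (λ p q → R p q ≡ S (σ p) (σ q)) a b c d →
  InducedP4 R a b c d → InducedP4 S (σ a) (σ b) (σ c) (σ d)
P4-map σ (on-pairs ab bc cd ac bd ad) (p4 ab' bc' cd' ac' bd' ad') =
  p4 (trans (sym ab) ab') (trans (sym bc) bc') (trans (sym cd) cd')
     (trans (sym ac) ac') (trans (sym bd) bd') (trans (sym ad) ad')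

P4-free-resp : ∀ {n} {R S : Rel₂ n} → R ≐ S → P4-free R → P4-free S
P4-free-resp {R = R} {S} R≐S free a b c d path =
  free a b c d (P4-map (λ x → x) (on-pairs (eq a b) (eq b c) (eq c d) (eq a c) (eq b d) (eq a d)) path)
  where
  eq : ∀ p q → S p q ≡ R p q
  eq p q = sym (R≐S p q)

cograph-≐ : ∀ {n} {K K' : Graph n} → adj K ≐ adj K' → IsCograph K → IsCograph K'
cograph-≐ {K = K} {K'} K≐K' cog = P4-free⇒cograph K' (P4-free-resp K≐K' (cograph⇒P4-free K cog))

module-no-split : ∀ {n} (K : Graph n) {m : VSet n} → IsModule K m → ∀ {x y z} →
  x ∈ m → y ∈ m → z ∉ m → adj K x z ≡ true → adj K y z ≡ false → ⊥
module-no-split K mod {x} {y} {z} x∈m y∈m z∉m xz yz =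
  true≢false (trans (sym xz) (trans (mod x y z x∈m y∈m z∉m) yz))

-- A P4 is prime: a module meets an induced P4 in all four of its
-- vertices, or misses an endpoint of each of its six pairs.
module-meets-P4 : ∀ {n} (K : Graph n) (m : VSet n) → IsModule K m → ∀ {a b c d} →
  InducedP4 (adj K) a b c d →
  OnPairs (λ p q → p ∈ m × q ∈ m) a b c d ⊎ OnPairs (λ p q → p ∉ m ⊎ q ∉ m) a b c d
module-meets-P4 K m mod {a} {b} {c} {d} (p4 ab bc cd ac bd ad)
  with m a in ea | m b in eb | m c in ec | m d in ed
... | true  | true  | true  | true  = inj₁ (on-pairs (ea , eb) (eb , ec) (ec , ed) (ea , ec) (eb , ed) (ea , ed))
... | false | false | false | false = inj₂ (on-pairs (inj₁ ea) (inj₁ eb) (inj₁ ec) (inj₁ ea) (inj₁ eb) (inj₁ ea))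
... | true  | false | false | false = inj₂ (on-pairs (inj₂ eb) (inj₁ eb) (inj₁ ec) (inj₂ ec) (inj₁ eb) (inj₂ ed))
... | false | true  | false | false = inj₂ (on-pairs (inj₁ ea) (inj₂ ec) (inj₁ ec) (inj₁ ea) (inj₂ ed) (inj₁ ea))
... | false | false | true  | false = inj₂ (on-pairs (inj₁ ea) (inj₁ eb) (inj₂ ed) (inj₁ ea) (inj₁ eb) (inj₁ ea))
... | false | false | false | true  = inj₂ (on-pairs (inj₁ ea) (inj₁ eb) (inj₁ ec) (inj₁ ea) (inj₁ eb) (inj₁ ea))
... | true  | true  | false | _     = ⊥-elim (module-no-split K mod eb ea ec bc ac)
... | true  | _     | true  | false = ⊥-elim (module-no-split K mod ec ea ed cd ad)
... | true  | false | _     | true  = ⊥-elim (module-no-split K mod ea ed eb ab (trans (symm K d b) bd))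
... | false | true  | true  | _     = ⊥-elim (module-no-split K mod eb ec ea (trans (symm K b a) ab) (trans (symm K c a) ac))
... | false | true  | false | true  = ⊥-elim (module-no-split K mod eb ed ea (trans (symm K b a) ab) (trans (symm K d a) ad))
... | false | false | true  | true  = ⊥-elim (module-no-split K mod ec ed eb (trans (symm K c b) bc) (trans (symm K d b) bd))

Admissible : ∀ {n} → Graph n → Rel₂ n → Set
Admissible G f =
  (∀ x y → f x y ≡ f y x) × (∀ x → f x x ≡ false) × P4-free (λ x y → adj G x y xor f x y)

admissible? : ∀ {n} (G : Graph n) (f : Rel₂ n) → Dec (Admissible G f)
admissible? G f =
  (all? λ x → all? λ y → f x y ≟ᵇ f y x) ×-dec (all? λ x → f x x ≟ᵇ false) ×-dec P4-free? _

admissible-resp : ∀ {n} (G : Graph n) {f g : Rel₂ n} → f ≐ g → Admissible G g → Admissible G f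
admissible-resp G f≐g (g-symm , g-irrefl , free) =
  (λ x y → trans (f≐g x y) (trans (g-symm x y) (sym (f≐g y x)))) ,
  (λ x → trans (f≐g x x) (g-irrefl x)) ,
  P4-free-resp (λ x y → cong (adj G x y xor_) (sym (f≐g x y))) free

-- Every graph has an optimal cograph edit set: minimise the size over all
-- admissible relations, among which adj G itself (deleting every edge of G).
optimal-exists : ∀ {n} (G : Graph n) → Σ (EditSet n) (IsOptimalEditSet G)
optimal-exists G
  with Search.least relations-cover cardRel (admissible? G) (admissible-resp G) cardRel-cong
         (symm G , irrefl G , edgeless)
  where
  edgeless : P4-free (λ x y → adj G x y xor adj G x y)
  edgeless a b c d path = true≢false (trans (sym (InducedP4.ab path)) (xor-same (adj G a b)))
... | f , (f-symm , f-irrefl , free) , f-least =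
  F , P4-free⇒cograph (G △ F) free ,
  λ F' cograph' → f-least (adj F') (symm F' , irrefl F' , cograph⇒P4-free (G △ F') cograph')
  where
  F : EditSet _
  F = record { adj = f ; symm = f-symm ; irrefl = f-irrefl }

-- Splitting edit counts along a vertex set M: `inside` counts edits between
-- vertices on the same side of M, `leaving` edits from M to its complement.
inside : Bool → Bool → Bool → ℕ
inside true  true  e = bool→ℕ e
inside false false e = bool→ℕ e
inside _     _     _ = 0

leaving : Bool → Bool → Bool → ℕ
leaving true false e = bool→ℕ e
leaving _    _     _ = 0

cut : ∀ {n} → VSet n → EditSet n → Fin n → Fin n → ℕ
cut M E x y = leaving (M x) (M y) (adj E x y)

cost : ∀ {n} → VSet n → EditSet n → Fin n → ℕ
cost M E x = ∑ (cut M E x)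

pairs-split : ∀ {n} (M : VSet n) (E : EditSet n) →
  pairs E ≡ ∑∑ (λ x y → inside (M x) (M y) (adj E x y)) + ∑∑ (cut M E) + ∑∑ (cut M E)
pairs-split M E = begin
  pairs E                         ≡⟨ ∑∑-cong pointwise ⟩
  ∑∑ (λ x y → I x y + C x y + C y x) ≡⟨ ∑∑-distrib-+ (λ x y → I x y + C x y) (λ x y → C y x) ⟩
  ∑∑ (λ x y → I x y + C x y) + ∑∑ (λ x y → C y x)
    ≡⟨ cong₂ _+_ (∑∑-distrib-+ I C) (sym (∑-comm C)) ⟩
  ∑∑ I + ∑∑ C + ∑∑ C              ∎
  where
  I C : Fin _ → Fin _ → ℕ
  I x y = inside (M x) (M y) (adj E x y)
  C = cut M E
  pointwise : ∀ x y → bool→ℕ (adj E x y) ≡ I x y + C x y + C y x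
  pointwise x y with M x | M y
  ... | true  | true  = sym (trans (+-identityʳ _) (+-identityʳ _))
  ... | false | false = sym (trans (+-identityʳ _) (+-identityʳ _))
  ... | true  | false = sym (+-identityʳ _)
  ... | false | true  = cong bool→ℕ (symm E x y)

xor-cancelˡ : ∀ a b → a xor (a xor b) ≡ b
xor-cancelˡ a b = trans (sym (xor-assoc a a b)) (cong (_xor b) (xor-same a))

-- Given an edit set F and a module M of G, re-edit G so that every member of M
-- is joined to the complement of M exactly as a cheapest member v is in G △ F,
-- leaving all edits inside M and outside M unchanged.
module Stabilise {n} (G : Graph n) (F : EditSet n) (M : VSet n) (M-module : IsModule G M)
                 (v : Fin n) (v∈M : v ∈ M) (v-cheapest : ∀ x → x ∈ M → cost M F v ≤ cost M F x) where

  H : Graph n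
  H = G △ F

  select : Bool → Bool → Fin n → Fin n → Bool
  select true  true  x y = adj H x y
  select true  false x y = adj H v y
  select false true  x y = adj H x v
  select false false x y = adj H x y

  H' : Graph n
  adj H' x y = select (M x) (M y) x y
  symm H' x y with M x | M y
  ... | true  | true  = symm H x y
  ... | true  | false = symm H v y
  ... | false | true  = symm H x v
  ... | false | false = symm H x y
  irrefl H' x with M x
  ... | true  = irrefl H x
  ... | false = irrefl H x

  F' : EditSet n
  adj F' x y = adj G x y xor adj H' x y
  symm F' x y = cong₂ _xor_ (symm G x y) (symm H' x y)
  irrefl F' x rewrite irrefl G x | irrefl H' x = refl

  G△F'≐H' : adj (G △ F') ≐ adj H'
  G△F'≐H' x y = xor-cancelˡ (adj G x y) (adj H' x y)

  H'-inside : ∀ {x y} → x ∈ M → y ∈ M → adj H' x y ≡ adj H x y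
  H'-inside x∈M y∈M rewrite x∈M | y∈M = refl

  H'-leaving : ∀ {x y} → x ∈ M → y ∉ M → adj H' x y ≡ adj H v y
  H'-leaving x∈M y∉M rewrite x∈M | y∉M = refl

  H'-entering : ∀ {x y} → x ∉ M → y ∈ M → adj H' x y ≡ adj H x v
  H'-entering x∉M y∈M rewrite x∉M | y∈M = refl

  H'-outside : ∀ {x y} → x ∉ M → y ∉ M → adj H' x y ≡ adj H x y
  H'-outside x∉M y∉M rewrite x∉M | y∉M = refl

  M-module' : IsModule H' M
  M-module' x y z x∈M y∈M z∉M = trans (H'-leaving x∈M z∉M) (sym (H'-leaving y∈M z∉M))

  collapse : Fin n → Fin n
  collapse w with M w
  ... | true  = v
  ... | false = w

  H'-collapse : ∀ {p q} → p ∉ M ⊎ q ∉ M → adj H' p q ≡ adj H (collapse p) (collapse q)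
  H'-collapse {p} {q} apart with M p | M q | apart
  ... | true  | true  | inj₁ ()
  ... | true  | true  | inj₂ ()
  ... | true  | false | _ = refl
  ... | false | true  | _ = refl
  ... | false | false | _ = refl

  -- An induced P4 of H' meets the module M fully (and lies in H[M]) or in at
  -- most one vertex (and collapses onto an induced P4 of H).
  H'-cograph : IsCograph H → IsCograph H'
  H'-cograph cograph = P4-free⇒cograph H' free'
    where
    free : P4-free (adj H)
    free = cograph⇒P4-free H cograph
    free' : P4-free (adj H')
    free' a b c d path with module-meets-P4 H' M M-module' path
    ... | inj₁ within = free a b c d (P4-map (λ x → x) (OnPairs-map (λ (p∈M , q∈M) → H'-inside p∈M q∈M) within) path)
    ... | inj₂ apart  = free _ _ _ _ (P4-map collapse (OnPairs-map H'-collapse apart) path)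

  inside-same : ∀ x y → inside (M x) (M y) (adj F' x y) ≡ inside (M x) (M y) (adj F x y)
  inside-same x y with M x | M y
  ... | true  | true  = cong bool→ℕ (xor-cancelˡ (adj G x y) (adj F x y))
  ... | false | false = cong bool→ℕ (xor-cancelˡ (adj G x y) (adj F x y))
  ... | true  | false = refl
  ... | false | true  = refl

  -- Every member of M now leaves M as v did: G agrees on x and v outside M.
  cut-as-v : ∀ x y → x ∈ M → cut M F' x y ≡ cut M F v y
  cut-as-v x y x∈M with M y in ey
  ... | true  rewrite x∈M | v∈M = refl
  ... | false rewrite x∈M | v∈M = cong bool→ℕ (begin
    adj G x y xor (adj G v y xor adj F v y) ≡⟨ cong (_xor (adj G v y xor adj F v y)) (M-module x v y x∈M v∈M ey) ⟩
    adj G v y xor (adj G v y xor adj F v y) ≡⟨ xor-cancelˡ (adj G v y) (adj F v y) ⟩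
    adj F v y                               ∎)

  -- No vertex leaves M along more edits than before, v being a cheapest member.
  cost-≤ : ∀ x → cost M F' x ≤ cost M F x
  cost-≤ x with member? x M
  ... | inj₁ x∈M = ≤-trans (≤-reflexive (sum-cong-≗ (λ y → cut-as-v x y x∈M))) (v-cheapest x x∈M)
  ... | inj₂ x∉M = ≤-reflexive (sum-cong-≗ nothing-leaves)
    where
    nothing-leaves : ∀ y → cut M F' x y ≡ cut M F x y
    nothing-leaves y rewrite x∉M = refl

  pairs-≤ : pairs F' ≤ pairs F
  pairs-≤ = subst₂ _≤_ (sym (pairs-split M F')) (sym (pairs-split M F))
    (+-mono-≤ (+-mono-≤ (≤-reflexive (∑∑-cong inside-same)) (∑-mono cost-≤)) (∑-mono cost-≤))

  module-kept : ∀ N → IsModule H N → Overlap-ok M N → IsModule H' N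
  module-kept N N-module (inj₁ disjoint) x y z x∈N y∈N z∉N with member? z M
  ... | inj₁ z∈M = begin
    adj H' x z  ≡⟨ H'-entering (disjoint-∉ disjoint x∈N) z∈M ⟩
    adj H x v   ≡⟨ N-module x y v x∈N y∈N (disjoint-∉ (λ w w∈N w∈M → disjoint w w∈M w∈N) v∈M) ⟩
    adj H y v   ≡⟨ sym (H'-entering (disjoint-∉ disjoint y∈N) z∈M) ⟩
    adj H' y z  ∎
  ... | inj₂ z∉M = begin
    adj H' x z  ≡⟨ H'-outside (disjoint-∉ disjoint x∈N) z∉M ⟩
    adj H x z   ≡⟨ N-module x y z x∈N y∈N z∉N ⟩
    adj H y z   ≡⟨ sym (H'-outside (disjoint-∉ disjoint y∈N) z∉M) ⟩
    adj H' y z  ∎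
  module-kept N N-module (inj₂ (inj₁ M⊆N)) x y z x∈N y∈N z∉N =
    trans (as-in-H x∈N) (trans (N-module x y z x∈N y∈N z∉N) (sym (as-in-H y∈N)))
    where
    z∉M : z ∉ M
    z∉M = ⊆-∉ M⊆N z∉N
    as-in-H : ∀ {w} → w ∈ N → adj H' w z ≡ adj H w z
    as-in-H {w} w∈N with member? w M
    ... | inj₁ w∈M = trans (H'-leaving w∈M z∉M) (N-module v w z (M⊆N v v∈M) w∈N z∉N)
    ... | inj₂ w∉M = H'-outside w∉M z∉M
  module-kept N N-module (inj₂ (inj₂ N⊆M)) x y z x∈N y∈N z∉N with member? z M
  ... | inj₁ z∈M = trans (H'-inside (N⊆M x x∈N) z∈M)
                     (trans (N-module x y z x∈N y∈N z∉N) (sym (H'-inside (N⊆M y y∈N) z∈M)))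
  ... | inj₂ z∉M = trans (H'-leaving (N⊆M x x∈N) z∉M) (sym (H'-leaving (N⊆M y y∈N) z∉M))

stabilise : ∀ {n} (G : Graph n) (F : EditSet n) → IsOptimalEditSet G F →
  (M : VSet n) → IsStrongModule G M →
  Σ (EditSet n) λ F' → IsOptimalEditSet G F' × IsModule (G △ F') M ×
    (∀ N → IsModule G N → IsModule (G △ F) N → IsModule (G △ F') N)
stabilise G F optimal M (M-module , M-strong) with any? (λ x → ∈? x M)
... | no empty = F , optimal , (λ x _ _ x∈M → ⊥-elim (empty (x , x∈M))) , (λ _ _ kept → kept)
... | yes (x₀ , x₀∈M)
  with Search.least vertices-cover (cost M F) (λ x → ∈? x M) (λ { refl x∈M → x∈M }) (cong (cost M F)) x₀∈M
...   | v , v∈M , v-cheapest =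
  F' , (cograph' , optimal') , module-≐ {K = H'} {G △ F'} H'≐G△F' M M-module' ,
  λ N N-module kept → module-≐ {K = H'} {G △ F'} H'≐G△F' N (module-kept N kept (M-strong N N-module))
  where
  open Stabilise G F M M-module v v∈M v-cheapest
  H'≐G△F' : adj H' ≐ adj (G △ F')
  H'≐G△F' x y = sym (G△F'≐H' x y)
  cograph' : IsCographEditSet G F'
  cograph' = cograph-≐ {K = H'} {G △ F'} H'≐G△F' (H'-cograph (proj₁ optimal))
  optimal' : ∀ F'' → IsCographEditSet G F'' → card F' ≤ card F''
  optimal' F'' cograph'' = ≤-trans (pairs-≤⇒card-≤ F' F pairs-≤) (proj₂ optimal F'' cograph'')

stabilise-all : ∀ {n} (G : Graph n) (L : List (VSet n)) (F : EditSet n) → IsOptimalEditSet G F →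
  Σ (EditSet n) λ F' → IsOptimalEditSet G F' ×
    (∀ N → IsStrongModule G N → Any (_≗ N) L ⊎ IsModule (G △ F) N → IsModule (G △ F') N)
stabilise-all G [] F optimal = F , optimal , λ { N _ (inj₁ ()) ; N _ (inj₂ kept) → kept }
stabilise-all G (M ∷ L) F optimal with strong? G M
... | no M-weak with stabilise-all G L F optimal
...   | F' , optimal' , keeps = F' , optimal' , λ
  { N N-strong (inj₁ (here M≗N)) → ⊥-elim (M-weak (strong-resp G (≗-sym M≗N) N-strong))
  ; N N-strong (inj₁ (there N∈L)) → keeps N N-strong (inj₁ N∈L)
  ; N N-strong (inj₂ kept) → keeps N N-strong (inj₂ kept) }
stabilise-all G (M ∷ L) F optimal | yes M-strong with stabilise G F optimal M M-strong
... | F₁ , optimal₁ , M-kept , keeps₁ with stabilise-all G L F₁ optimal₁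
...   | F' , optimal' , keeps = F' , optimal' , λ
  { N N-strong (inj₁ (here M≗N)) → keeps N N-strong (inj₂ (module-resp (G △ F₁) M≗N M-kept))
  ; N N-strong (inj₁ (there N∈L)) → keeps N N-strong (inj₁ N∈L)
  ; N N-strong (inj₂ kept) → keeps N N-strong (inj₂ (keeps₁ N (proj₁ N-strong) kept)) }

module-preserving-optimal : ∀ {n} (G : Graph n) →
  Σ (EditSet n) λ F → IsOptimalEditSet G F × (∀ N → IsStrongModule G N → IsModule (G △ F) N)
module-preserving-optimal {n} G with optimal-exists G
... | F₀ , optimal₀ with stabilise-all G (vsets n) F₀ optimal₀
...   | F , optimal , keeps = F , optimal , λ N N-strong → keeps N N-strong (inj₁ (vsets-cover N))

⟦_⟧ : ∀ {n} {P : Fin n → Set} → (∀ x → Dec (P x)) → VSet n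
⟦ P? ⟧ x = does (P? x)

∈⟦⟧⁺ : ∀ {n} {P : Fin n → Set} (P? : ∀ x → Dec (P x)) {x} → P x → x ∈ ⟦ P? ⟧
∈⟦⟧⁺ P? {x} px = dec-true (P? x) px

∈⟦⟧⁻ : ∀ {n} {P : Fin n → Set} (P? : ∀ x → Dec (P x)) {x} → x ∈ ⟦ P? ⟧ → P x
∈⟦⟧⁻ P? {x} x∈ with P? x
... | yes px = px

singleton : ∀ {n} → Fin n → VSet n
singleton x = ⟦ _≟ᶠ x ⟧

singleton-strong : ∀ {n} (G : Graph n) (x : Fin n) → IsStrongModule G (singleton x)
singleton-strong G x = one-vertex , λ M' _ → overlaps M'
  where
  one-vertex : IsModule G (singleton x)
  one-vertex a b z a∈ b∈ _ = cong (λ w → adj G w z) (trans (∈⟦⟧⁻ (_≟ᶠ x) a∈) (sym (∈⟦⟧⁻ (_≟ᶠ x) b∈)))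
  overlaps : ∀ M' → Overlap-ok (singleton x) M'
  overlaps M' with member? x M'
  ... | inj₁ x∈M' = inj₂ (inj₁ λ y y∈ → subst (_∈ M') (sym (∈⟦⟧⁻ (_≟ᶠ x) y∈)) x∈M')
  ... | inj₂ x∉M' = inj₁ λ z z∈ z∈M' →
          true≢false (trans (sym z∈M') (subst (_∉ M') (sym (∈⟦⟧⁻ (_≟ᶠ x) z∈)) x∉M'))

everything : ∀ {n} → VSet n
everything _ = true

everything-strong : ∀ {n} (G : Graph n) → IsStrongModule G everything
everything-strong G = (λ x y z _ _ ()) , λ M' _ → inj₂ (inj₂ λ _ _ → refl)

size : ∀ {n} → VSet n → ℕ
size A = ∑ (λ x → bool→ℕ (A x))

size-resp : ∀ {n} {A B : VSet n} → A ≗ B → size A ≡ size B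
size-resp A≗B = sum-cong-≗ (λ x → cong bool→ℕ (A≗B x))

size-mono : ∀ {n} {A B : VSet n} → A ⊆ B → ∀ x → bool→ℕ (A x) ≤ bool→ℕ (B x)
size-mono {A = A} A⊆B x with member? x A
... | inj₁ x∈A rewrite x∈A | A⊆B x x∈A = ≤-refl
... | inj₂ x∉A rewrite x∉A = z≤n

size-≤ : ∀ {n} (A : VSet n) → size A ≤ size (everything {n})
size-≤ A = ∑-mono (size-mono {A = A} {everything} (λ _ _ → refl))

⊆⇒⊇⊎< : ∀ {n} {A B : VSet n} → A ⊆ B → B ⊆ A ⊎ size A < size B
⊆⇒⊇⊎< {A = A} {B} A⊆B with any? (λ x → ∈? x B ×-dec ∉? x A)
... | yes (x , x∈B , x∉A) = inj₂ (∑-strict (size-mono {A = A} {B} A⊆B) x one-more)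
  where
  one-more : bool→ℕ (A x) < bool→ℕ (B x)
  one-more rewrite x∈B | x∉A = s≤s z≤n
... | no none = inj₁ λ x x∈B → ¬∉⇒∈ {A = A} (λ x∉A → none (x , x∈B , x∉A))

record ProperOverlap {n} (A B : VSet n) : Set where
  constructor proper
  field
    common : ∃ λ x → x ∈ A × x ∈ B
    onlyA  : ∃ λ x → x ∈ A × x ∉ B
    onlyB  : ∃ λ x → x ∈ B × x ∉ A

overlap-cases : ∀ {n} (A B : VSet n) → Overlap-ok A B ⊎ ProperOverlap A B
overlap-cases A B
  with any? (λ x → ∈? x A ×-dec ∈? x B) | any? (λ x → ∈? x A ×-dec ∉? x B) | any? (λ x → ∈? x B ×-dec ∉? x A)
... | no none | _ | _ = inj₁ (inj₁ λ z z∈A z∈B → none (z , z∈A , z∈B))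
... | yes _ | no none | _ = inj₁ (inj₂ (inj₁ λ x x∈A → ¬∉⇒∈ {A = B} (λ x∉B → none (x , x∈A , x∉B))))
... | yes _ | yes _ | no none = inj₁ (inj₂ (inj₂ λ x x∈B → ¬∉⇒∈ {A = A} (λ x∉A → none (x , x∈B , x∉A))))
... | yes common | yes onlyA | yes onlyB = inj₂ (proper common onlyA onlyB)

module Walks {n} (R : Rel₂ n) (P : VSet n) where

  snoc : ∀ {a b c} → Reach R P a b → R b c ≡ true → c ∈ P → Reach R P a c
  snoc here bc c∈P = step bc c∈P here
  snoc (step ay y∈P walk) bc c∈P = step ay y∈P (snoc walk bc c∈P)

  _++ʷ_ : ∀ {a b c} → Reach R P a b → Reach R P b c → Reach R P a c
  here ++ʷ walk' = walk'
  step ay y∈P walk ++ʷ walk' = step ay y∈P (walk ++ʷ walk')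

  reverse : (∀ x y → R x y ≡ R y x) → ∀ {a b} → Reach R P a b → a ∈ P → Reach R P b a
  reverse R-symm here a∈P = here
  reverse R-symm {a} (step {y = y} ay y∈P walk) a∈P = snoc (reverse R-symm walk y∈P) (trans (R-symm y a) ay) a∈P

  Closed : VSet n → Set
  Closed K = ∀ u w → u ∈ K → w ∈ P → R u w ≡ true → w ∈ K

  walk-stays : ∀ {K} → Closed K → ∀ {a b} → a ∈ K → Reach R P a b → b ∈ K
  walk-stays closed a∈K here = a∈K
  walk-stays closed {a} a∈K (step {y = y} ay y∈P walk) = walk-stays closed (closed a y a∈K y∈P ay) walk

  crossing : ∀ {A a b} → Reach R P a b → a ∈ A → b ∉ A →
    ∃ λ u → ∃ λ w → Reach R P a u × u ∈ A × w ∉ A × w ∈ P × R u w ≡ true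
  crossing here a∈A a∉A = ⊥-elim (true≢false (trans (sym a∈A) a∉A))
  crossing {A} {a} (step {y = y} ay y∈P walk) a∈A b∉A with member? y A
  ... | inj₂ y∉A = a , y , here , a∈A , y∉A , y∈P , ay
  ... | inj₁ y∈A with crossing walk y∈A b∉A
  ...   | u , w , yu , u∈A , w∉A , w∈P , uw = u , w , step ay y∈P yu , u∈A , w∉A , w∈P , uw

record Component {n} (R : Rel₂ n) (P : VSet n) (x : Fin n) : Set where
  field
    K         : VSet n
    x∈K       : x ∈ K
    K⊆P       : K ⊆ P
    closed    : Walks.Closed R P K
    reachable : ∀ w → w ∈ K → Reach R P x w

-- Components are computed as the limit of the layers {w | w is reachable from x
-- in at most k steps}; the layers grow strictly until they become stable.
module Layers {n} (R : Rel₂ n) (P : VSet n) (x : Fin n) (x∈P : x ∈ P) where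
  open Walks R P

  layer : ℕ → VSet n
  next? : ∀ k w → Dec (w ∈ layer k ⊎ (w ∈ P × ∃ λ u → u ∈ layer k × R u w ≡ true))

  layer zero = singleton x
  layer (suc k) = ⟦ next? k ⟧

  next? k w = ∈? w (layer k) ⊎-dec (∈? w P ×-dec any? λ u → ∈? u (layer k) ×-dec (R u w ≟ᵇ true))

  layer-extends : ∀ k → layer k ⊆ layer (suc k)
  layer-extends k w w∈ = ∈⟦⟧⁺ (next? k) (inj₁ w∈)

  layer-grows : ∀ k u w → u ∈ layer k → w ∈ P → R u w ≡ true → w ∈ layer (suc k)
  layer-grows k u w u∈ w∈P uw = ∈⟦⟧⁺ (next? k) (inj₂ (w∈P , u , u∈ , uw))

  layer-reachable : ∀ k w → w ∈ layer k → Reach R P x w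
  layer-reachable zero w w∈ = subst (Reach R P x) (sym (∈⟦⟧⁻ (_≟ᶠ x) w∈)) here
  layer-reachable (suc k) w w∈ with ∈⟦⟧⁻ (next? k) w∈
  ... | inj₁ w∈layer = layer-reachable k w w∈layer
  ... | inj₂ (w∈P , u , u∈layer , uw) = snoc (layer-reachable k u u∈layer) uw w∈P

  layer-⊆P : ∀ k → layer k ⊆ P
  layer-⊆P zero w w∈ = subst (_∈ P) (sym (∈⟦⟧⁻ (_≟ᶠ x) w∈)) x∈P
  layer-⊆P (suc k) w w∈ with ∈⟦⟧⁻ (next? k) w∈
  ... | inj₁ w∈layer = layer-⊆P k w w∈layer
  ... | inj₂ (w∈P , _) = w∈P

  x∈layer : ∀ k → x ∈ layer k
  x∈layer zero = ∈⟦⟧⁺ (_≟ᶠ x) refl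
  x∈layer (suc k) = layer-extends k x (x∈layer k)

  Stable : Set
  Stable = ∃ λ j → layer (suc j) ⊆ layer j

  growth : ∀ k → Stable ⊎ k ≤ size (layer k)
  growth zero = inj₂ z≤n
  growth (suc k) with growth k
  ... | inj₁ stable = inj₁ stable
  ... | inj₂ k≤size with ⊆⇒⊇⊎< (layer-extends k)
  ...   | inj₁ stable = inj₁ (k , stable)
  ...   | inj₂ bigger = inj₂ (≤-<-trans k≤size bigger)

  stable : Stable
  stable with growth (suc (size (everything {n})))
  ... | inj₁ s = s
  ... | inj₂ too-big = ⊥-elim (<⇒≱ too-big (size-≤ (layer (suc (size (everything {n}))))))

  component : Component R P x
  component = record
    { K = layer j
    ; x∈K = x∈layer j
    ; K⊆P = layer-⊆P j
    ; closed = λ u w u∈ w∈P uw → layer-stable w (layer-grows j u w u∈ w∈P uw)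
    ; reachable = layer-reachable j }
    where
    j : ℕ
    j = proj₁ stable
    layer-stable : layer (suc j) ⊆ layer j
    layer-stable = proj₂ stable

component : ∀ {n} (R : Rel₂ n) (P : VSet n) (x : Fin n) → x ∈ P → Component R P x
component R P x x∈P = Layers.component R P x x∈P

-- Connectivity of G (f = id) or of its complement (f = not) inside modules:
-- R a b = f (adj G a b) for an injective f.
module Connectivity {n} (G : Graph n) (f : Bool → Bool) (f-injective : ∀ {a b} → f a ≡ f b → a ≡ b) where

  R : Rel₂ n
  R a b = f (adj G a b)

  R-symm : ∀ a b → R a b ≡ R b a
  R-symm a b = cong f (symm G a b)

  isolated-module : ∀ {P X : VSet n} → IsModule G P → X ⊆ P →
    (∀ u z → u ∈ X → z ∈ P → z ∉ X → R u z ≡ false) → IsModule G X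
  isolated-module {P} P-module X⊆P isolated u u' z u∈X u'∈X z∉X with member? z P
  ... | inj₁ z∈P = f-injective (trans (isolated u z u∈X z∈P z∉X) (sym (isolated u' z u'∈X z∈P z∉X)))
  ... | inj₂ z∉P = P-module u u' z (X⊆P u u∈X) (X⊆P u' u'∈X) z∉P

  no-edge-out : ∀ {P K : VSet n} → Walks.Closed R P K → ∀ u z → u ∈ K → z ∈ P → z ∉ K → R u z ≡ false
  no-edge-out closed u z u∈K z∈P z∉K with R u z in uz
  ... | true  = ⊥-elim (true≢false (trans (sym (closed u z u∈K z∈P uz)) z∉K))
  ... | false = refl

  component-strong : ∀ {P x} → IsStrongModule G P → (C : Component R P x) → IsStrongModule G (Component.K C)
  component-strong {P} {x} (P-module , P-strong) C =
    isolated-module P-module K⊆P (no-edge-out closed) , overlaps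
    where
    open Component C
    open Walks R P
    -- a walk in K from K ∩ M' to K ∖ M' crosses M' along an edge u w', and
    -- then M' ∖ K can be neither inside P (it would join K) nor outside P
    no-proper-overlap : ∀ M' → IsModule G M' → ProperOverlap K M' → ⊥
    no-proper-overlap M' M'-module (proper (a , a∈K , a∈M') (b , b∈K , b∉M') (w , w∈M' , w∉K))
      with crossing (reverse R-symm (reachable a a∈K) (K⊆P x x∈K) ++ʷ reachable b b∈K) a∈M' b∉M'
    ...   | u , w' , au , u∈M' , w'∉M' , w'∈P , uw' with member? w P
    ...     | inj₁ w∈P = true≢false (trans (sym (closed w' w w'∈K w∈P w'w)) w∉K)
      where
      u∈K : u ∈ K
      u∈K = walk-stays closed a∈K au
      w'∈K : w' ∈ K
      w'∈K = closed u w' u∈K w'∈P uw'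
      -- w and u cannot be told apart by w' ∉ M'
      w'w : R w' w ≡ true
      w'w = trans (R-symm w' w) (trans (cong f (sym (M'-module u w w' u∈M' w∈M' w'∉M'))) uw')
    ...     | inj₂ w∉P with P-strong M' M'-module
    ...       | inj₁ disjoint = disjoint a (K⊆P a a∈K) a∈M'
    ...       | inj₂ (inj₁ P⊆M') = true≢false (trans (sym (P⊆M' b (K⊆P b b∈K))) b∉M')
    ...       | inj₂ (inj₂ M'⊆P) = true≢false (trans (sym (M'⊆P w w∈M')) w∉P)
    overlaps : ∀ M' → IsModule G M' → Overlap-ok K M'
    overlaps M' M'-module with overlap-cases K M'
    ... | inj₁ ok = ok
    ... | inj₂ proper-overlap = ⊥-elim (no-proper-overlap M' M'-module proper-overlap)

  module Hull {M P : VSet n} (P-strong : IsStrongModule G P) (M⊆P : M ⊆ P)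
              (P-least : ∀ Q → IsStrongModule G Q → M ⊆ Q → P ⊆ Q)
              (overlaps : ∀ Q → IsStrongModule G Q → Overlap-ok M Q) where
    open Walks R P
    open Component

    -- A component containing M is a strong module containing M, hence all of P.
    spanning : ∀ {z} (Cz : Component R P z) → M ⊆ K Cz → ConnectedOn R P
    spanning {z} Cz M⊆Kz x y x∈P y∈P =
      reverse R-symm (reachable Cz x (P⊆Kz x x∈P)) (K⊆P Cz z (x∈K Cz)) ++ʷ reachable Cz y (P⊆Kz y y∈P)
      where
      P⊆Kz : P ⊆ K Cz
      P⊆Kz = P-least (K Cz) (component-strong P-strong Cz) M⊆Kz

    -- If P is not R-connected, M is disjoint from the component of every
    -- z ∈ P ∖ M, so no R-edge joins M to z.
    isolated : ¬ ConnectedOn R P → ∀ u z → u ∈ M → z ∈ P → z ∉ M → R u z ≡ false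
    isolated disconnected u z u∈M z∈P z∉M = through (component R P z z∈P)
      where
      through : (Cz : Component R P z) → R u z ≡ false
      through Cz with R u z in uz | overlaps (K Cz) (component-strong P-strong Cz)
      ... | false | _ = refl
      ... | true | inj₁ disjoint =
        ⊥-elim (disjoint u u∈M (closed Cz z u (x∈K Cz) (M⊆P u u∈M) (trans (R-symm z u) uz)))
      ... | true | inj₂ (inj₁ M⊆Kz) = ⊥-elim (disconnected (spanning Cz M⊆Kz))
      ... | true | inj₂ (inj₂ Kz⊆M) = ⊥-elim (true≢false (trans (sym (Kz⊆M z (x∈K Cz))) z∉M))

    connected : ¬ IsModule G M → ConnectedOn R P
    connected ¬M-module x y x∈P y∈P = via (component R P x x∈P)
      where
      via : Component R P x → Reach R P x y
      via Cx with member? y (K Cx)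
      ... | inj₁ y∈Kx = reachable Cx y y∈Kx
      ... | inj₂ y∉Kx = ⊥-elim (¬M-module (isolated-module (proj₁ P-strong) M⊆P (isolated disconnected)))
        where
        disconnected : ¬ ConnectedOn R P
        disconnected conn =
          true≢false (trans (sym (walk-stays (closed Cx) (x∈K Cx) (conn x y x∈P y∈P))) y∉Kx)

non-module-two : ∀ {n} (G : Graph n) (M : VSet n) → ¬ IsModule G M → AtLeastTwo M
non-module-two G M ¬module with any? (λ x → any? λ y → ∈? x M ×-dec ∈? y M ×-dec ¬? (x ≟ᶠ y))
... | yes two = two
... | no none = ⊥-elim (¬module λ x y z x∈M y∈M _ →
        cong (λ w → adj G w z) (decidable-stable (x ≟ᶠ y) (λ x≢y → none (x , y , x∈M , y∈M , x≢y))))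

hull : ∀ {n} (G : Graph n) (M : VSet n) {x} → x ∈ M →
  Σ (VSet n) λ P → IsStrongModule G P × M ⊆ P × (∀ Q → IsStrongModule G Q → M ⊆ Q → P ⊆ Q)
hull G M {x} x∈M
  with Search.least vsets-cover size (λ Q → strong? G Q ×-dec ⊆? M Q)
         (λ Q≗Q' (strong' , M⊆Q') → strong-resp G (≗-sym Q≗Q') strong' , ⊆-resp (λ _ → refl) (≗-sym Q≗Q') M⊆Q')
         size-resp (everything-strong G , λ _ _ → refl)
... | P , (P-strong , M⊆P) , P-smallest = P , P-strong , M⊆P , P-least
  where
  P-least : ∀ Q → IsStrongModule G Q → M ⊆ Q → P ⊆ Q
  P-least Q Q-strong M⊆Q with proj₂ P-strong Q (proj₁ Q-strong)
  ... | inj₁ disjoint = ⊥-elim (disjoint x (M⊆P x x∈M) (M⊆Q x x∈M))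
  ... | inj₂ (inj₁ P⊆Q) = P⊆Q
  ... | inj₂ (inj₂ Q⊆P) with ⊆⇒⊇⊎< Q⊆P
  ...   | inj₁ P⊆Q = P⊆Q
  ...   | inj₂ smaller = ⊥-elim (<⇒≱ smaller (P-smallest Q (Q-strong , M⊆Q)))

complement : ∀ {n} → VSet n → VSet n
complement A x = not (A x)

complement-⊆ : ∀ {n} {A B : VSet n} → A ⊆ B → complement B ⊆ complement A
complement-⊆ {A = A} A⊆B x x∉B with member? x A
... | inj₁ x∈A = ⊥-elim (true≢false (trans (sym x∉B) (cong not (A⊆B x x∈A))))
... | inj₂ x∉A = cong not x∉A

complement-⊆⁻ : ∀ {n} {A B : VSet n} → complement B ⊆ complement A → A ⊆ B
complement-⊆⁻ {B = B} cB⊆cA x x∈A = ¬∉⇒∈ {A = B} λ x∉B →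
  true≢false (trans (sym (cB⊆cA x (cong not x∉B))) (cong not x∈A))

-- In a strong module P with two members, every x ∈ P lies in a member of
-- P_max(G[P]): the largest strong module properly inside P containing x.
child : ∀ {n} (G : Graph n) (P : VSet n) → AtLeastTwo P → ∀ x → x ∈ P →
  Σ (VSet n) λ C → InPmax G P C × x ∈ C
child G P (x₁ , x₂ , x₁∈P , x₂∈P , x₁≢x₂) x x∈P
  with Search.least vsets-cover (λ Q → size (complement Q))
         (λ Q → strong? G Q ×-dec (⊆? Q P ×-dec any? (λ y → ∈? y P ×-dec ∉? y Q)) ×-dec ∈? x Q)
         (λ Q≗Q' (strong' , (Q'⊆P , y , y∈P , y∉Q') , x∈Q') →
            strong-resp G (≗-sym Q≗Q') strong' , (⊆-resp (≗-sym Q≗Q') (λ _ → refl) Q'⊆P , y , y∈P , ∉-resp (≗-sym Q≗Q') y∉Q') ,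
            ∈-resp (≗-sym Q≗Q') x∈Q')
         (λ Q≗Q' → size-resp (λ y → cong not (Q≗Q' y)))
         (singleton-strong G x , (singleton⊆P , other) , ∈⟦⟧⁺ (_≟ᶠ x) refl)
  where
  singleton⊆P : singleton x ⊆ P
  singleton⊆P y y∈ = subst (_∈ P) (sym (∈⟦⟧⁻ (_≟ᶠ x) y∈)) x∈P
  other : ∃ λ y → y ∈ P × y ∉ singleton x
  other with x₁ ≟ᶠ x
  ... | yes refl = x₂ , x₂∈P , dec-false (x₂ ≟ᶠ x₁) (λ x₂≡x₁ → x₁≢x₂ (sym x₂≡x₁))
  ... | no x₁≢x = x₁ , x₁∈P , dec-false (x₁ ≟ᶠ x) x₁≢x
... | C , (C-strong , C⊂P , x∈C) , C-largest = C , (C-strong , C⊂P , maximal) , x∈C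
  where
  maximal : ∀ M'' → IsStrongModule G M'' → M'' ⊂ P → C ⊆ M'' → M'' ⊆ C
  maximal M'' M''-strong M''⊂P C⊆M'' with ⊆⇒⊇⊎< (complement-⊆ C⊆M'')
  ... | inj₁ cC⊆cM'' = complement-⊆⁻ cC⊆cM''
  ... | inj₂ smaller = ⊥-elim (<⇒≱ smaller (C-largest M'' (M''-strong , M''⊂P , C⊆M'' x x∈C)))

cover-by : ∀ {n} {M : VSet n} {Good : VSet n → Set} →
  (∀ x → x ∈ M → Σ (VSet n) λ C → Good C × x ∈ C) → (xs : List (Fin n)) →
  Σ (List (VSet n)) λ Ms → All Good Ms × (∀ x → x ∈ M → Any (_≡ x) xs → InUnion Ms x)
cover-by pick [] = [] , All.[] , λ _ _ ()
cover-by {M = M} pick (y ∷ ys) with cover-by pick ys | member? y M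
... | Ms , good , covers | inj₂ y∉M = Ms , good , λ
  { x x∈M (here refl) → ⊥-elim (true≢false (trans (sym x∈M) y∉M))
  ; x x∈M (there x∈ys) → covers x x∈M x∈ys }
... | Ms , good , covers | inj₁ y∈M with pick y y∈M
...   | C , good-C , y∈C = C ∷ Ms , good-C All.∷ good , λ
  { x x∈M (here refl) → here y∈C
  ; x x∈M (there x∈ys) → there (covers x x∈M x∈ys) }

two-⊆ : ∀ {n} {A B : VSet n} → A ⊆ B → AtLeastTwo A → AtLeastTwo B
two-⊆ A⊆B (x₁ , x₂ , x₁∈A , x₂∈A , x₁≢x₂) = x₁ , x₂ , A⊆B x₁ x₁∈A , A⊆B x₂ x₂∈A , x₁≢x₂

child-inside : ∀ {n} (G : Graph n) {M P : VSet n} → AtLeastTwo P → M ⊆ P →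
  (∀ Q → IsStrongModule G Q → M ⊆ Q → P ⊆ Q) → (∀ Q → IsStrongModule G Q → Overlap-ok M Q) →
  ∀ x → x ∈ M → Σ (VSet n) λ C → (InPmax G P C × C ⊆ M) × x ∈ C
child-inside G {M} {P} P-two M⊆P P-least overlaps x x∈M with child G P P-two x (M⊆P x x∈M)
... | C , C-max@(C-strong , (_ , w , w∈P , w∉C) , _) , x∈C with overlaps C C-strong
...   | inj₁ disjoint = ⊥-elim (disjoint x x∈M x∈C)
...   | inj₂ (inj₂ C⊆M) = C , (C-max , C⊆M) , x∈C
...   | inj₂ (inj₁ M⊆C) = ⊥-elim (true≢false (trans (sym (P-least C C-strong M⊆C w w∈P)) w∉C))

merge-of-children : ∀ {n} (G H : Graph n) → (∀ N → IsStrongModule G N → IsModule H N) →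
  ∀ (M : VSet n) → IsStrongModule H M → ¬ IsModule G M →
  ∃ λ (P : VSet n) → IsPrimeModule G P ×
    ∃ λ (Ms : List (VSet n)) → All (InPmax G P) Ms × MergedInto G H Ms M
merge-of-children {n} G H keeps M (M-module , M-strong) ¬M-module
  with non-module-two G M ¬M-module
... | M-two@(_ , _ , x₁∈M , _) with hull G M x₁∈M
...   | P , P-strong , M⊆P , P-least
  with cover-by (child-inside G (two-⊆ M⊆P M-two) M⊆P P-least (λ Q Q-strong → M-strong Q (keeps Q Q-strong))) (allFin n)
...     | Ms , children , covers = P , prime , Ms , All.map proj₁ children , merged
  where
  overlaps : ∀ Q → IsStrongModule G Q → Overlap-ok M Q
  overlaps Q Q-strong = M-strong Q (keeps Q Q-strong)
  open Connectivity using (module Hull)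
  prime : IsPrimeModule G P
  prime = P-strong , two-⊆ M⊆P M-two ,
    Hull.connected G (λ b → b) (λ e → e) P-strong M⊆P P-least overlaps ¬M-module ,
    Hull.connected G not not-injective P-strong M⊆P P-least overlaps ¬M-module
  merged : MergedInto G H Ms M
  merged = All.map (λ ((C-strong , _) , _) → proj₁ C-strong) children ,
           All.map (λ ((C-strong , _) , _) → keeps _ C-strong) children ,
           M-module , ¬M-module ,
           λ x → mk⇔ (λ x∈M → covers x x∈M (vertices-cover x))
                     (All.lookupWith (λ (_ , C⊆M) x∈C → C⊆M x x∈C) children)

theorem6 : ∀ {n : ℕ} (G : Graph n) →
    ∃ λ (F : EditSet n) → IsOptimalEditSet G F ×
      (∀ (M : VSet n) → IsStrongModule (G △ F) M → ¬ IsModule G M →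
        ∃ λ (P : VSet n) → IsPrimeModule G P ×
          ∃ λ (Ms : List (VSet n)) → All (InPmax G P) Ms × MergedInto G (G △ F) Ms M)
theorem6 G with module-preserving-optimal G
... | F , optimal , keeps = F , optimal , merge-of-children G (G △ F) keeps
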